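{- If $G$ is a connected graph that is a cycle, a forest, a complete graph, or a complete bipartite graph, then every BFS ordering of $G$ is a LexBFS ordering of $G$.
   Context: All graphs are finite and simple. For an ordering $\sigma$ of $V(G)$ write $x<_\sigma y$ if $x$ precedes $y$. $\sigma$ is a BFS ordering if whenever $a<_\sigma b<_\sigma c$, $ac\in E(G)$, $ab\notin E(G)$, there is $d$ with $d<_\sigma a$ and $db\in E(G)$; it is a LexBFS ordering if under the same conditions there is $d$ with $d<_\sigma a$, $db\in E(G)$ and $dc\notin E(G)$. -}

module Defs where

open import Data.Nat using (ℕ; zero; suc; _≤_)
open import Data.Fin using (Fin; toℕ; inject₁; fromℕ; _<_)
open import Data.Bool using (Bool; true; false; T)
open import Data.Product using (Σ; ∃; _×_; _,_)
open import Data.Sum using (_⊎_)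
open import Data.Empty using (⊥)
open import Relation.Nullary using (¬_)
open import Relation.Binary.PropositionalEquality using (_≡_; _≢_)
open import Function.Definitions using (Injective)
open import Function.Bundles using (_⇔_)

record Graph (n : ℕ) : Set where
  field
    adj   : Fin n → Fin n → Bool
    sym   : ∀ x y → adj x y ≡ adj y x
    irref : ∀ x → adj x x ≡ false

module _ {n : ℕ} (G : Graph n) where
  open Graph G

  Edge : Fin n → Fin n → Set
  Edge x y = T (adj x y)

  data Walk : Fin n → Fin n → Set where
    here : ∀ {x} → Walk x x
    step : ∀ {x y z} → Edge x y → Walk y z → Walk x z

  Connected : Set
  Connected = ∀ x y → Walk x y

  HasCycle : Set
  HasCycle = Σ ℕ λ k → Σ (Fin (suc (suc (suc k))) → Fin n) λ c →
    Injective _≡_ _≡_ c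
    × (∀ (i : Fin (suc (suc k))) → Edge (c (inject₁ i)) (c (Fin.suc i)))
    × Edge (c (fromℕ (suc (suc k)))) (c Fin.zero)

  IsForest : Set
  IsForest = ¬ HasCycle

  IsComplete : Set
  IsComplete = ∀ x y → x ≢ y → Edge x y

  IsCompleteBipartite : Set
  IsCompleteBipartite = Σ (Fin n → Bool) λ side →
    ∀ x y → (Edge x y ⇔ (side x ≢ side y))

  CycAdj : Fin n → Fin n → Set
  CycAdj i j = (suc (toℕ i) ≡ toℕ j) ⊎ (suc (toℕ j) ≡ toℕ i)
             ⊎ ((toℕ i ≡ 0) × (suc (toℕ j) ≡ n))
             ⊎ ((toℕ j ≡ 0) × (suc (toℕ i) ≡ n))

  -- G is (isomorphic to) the cycle C_n, n ≥ 3
  IsCycle : Set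
  IsCycle = (3 ≤ n) × Σ (Fin n → Fin n) λ f →
    Injective _≡_ _≡_ f × (∀ i j → (Edge (f i) (f j) ⇔ CycAdj i j))

-- a vertex ordering σ: an injective (hence bijective) position map
record Ordering (n : ℕ) : Set where
  field
    pos    : Fin n → Fin n
    pos-inj : Injective _≡_ _≡_ pos

module _ {n : ℕ} where
  _<[_]_ : Fin n → Ordering n → Fin n → Set
  x <[ σ ] y = Ordering.pos σ x < Ordering.pos σ y

module _ {n : ℕ} (G : Graph n) (σ : Ordering n) where

  IsBFS : Set
  IsBFS = ∀ a b c → a <[ σ ] b → b <[ σ ] c →
    Edge G a c → ¬ Edge G a b →
    Σ (Fin n) λ d → d <[ σ ] a × Edge G d b

  IsLexBFS : Set
  IsLexBFS = ∀ a b c → a <[ σ ] b → b <[ σ ] c →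
    Edge G a c → ¬ Edge G a b →
    Σ (Fin n) λ d → d <[ σ ] a × Edge G d b × ¬ Edge G d c

-- For a <σ b <σ c with ac an edge and ab not, the BFS property yields d <σ a
-- adjacent to b; this d witnesses the LexBFS property unless it is also adjacent
-- to c, and each class excludes that.  In a complete graph a and b are adjacent.
-- In a complete bipartite graph a, c, d, b would be a walk of length three between
-- the non-adjacent, hence same-sided, a and b.  In a connected graph with a BFS
-- ordering every vertex descends along earlier neighbours to the first vertex, so
-- two earlier neighbours a, d of c are joined by a walk avoiding c, which closes a
-- cycle: in a forest c has at most one earlier neighbour.  In a cycle d has only the
-- neighbours b and c, so it is the first vertex; the BFS property then makes d
-- adjacent to every vertex before its neighbour c, in particular to a.

module Submission where

open import Defs
open import Data.Nat as ℕ using (ℕ; zero; suc)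
import Data.Nat.Properties as ℕ
open import Data.Fin as Fin using (Fin; toℕ; inject₁; fromℕ; punchOut)
open import Data.Fin.Properties
  using (toℕ-injective; toℕ<n; any?; punchOut-injective; <⇒notInjective;
         <-irrefl; <-cmp; <-trans; ≤-refl; ≤-trans)
open import Data.Fin.Induction using (<-wellFounded)
open import Data.Bool using (T; not)
import Data.Bool as Bool
open import Data.Bool.Properties using (¬-not)
open import Data.Product using (Σ; ∃; _×_; _,_)
open import Data.Sum using (_⊎_; inj₁; inj₂)
import Data.Sum as Sum
open import Data.Empty using (⊥; ⊥-elim)
open import Data.Unit using (⊤; tt)
open import Function using (_∘_; id)
open import Function.Bundles using (Equivalence)
open import Function.Definitions using (Injective)
open import Induction.WellFounded using (WellFounded; Acc; acc)
open import Relation.Binary using (tri<; tri≈; tri>)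
import Relation.Binary.Construct.On as On
open import Relation.Nullary using (¬_; Dec; yes; no)
open import Relation.Nullary.Decidable using (_⊎-dec_; T?)
open import Relation.Binary.PropositionalEquality
  using (_≡_; _≢_; refl; sym; trans; cong; subst)

injective⇒surjective : ∀ {n} {f : Fin n → Fin n} → Injective _≡_ _≡_ f →
                       ∀ y → ∃ λ i → f i ≡ y
injective⇒surjective {zero} _ ()
injective⇒surjective {suc m} {f} f-inj y with any? (λ i → f i Fin.≟ y)
... | yes hit = hit
... | no miss = ⊥-elim (<⇒notInjective (ℕ.n<1+n m) punchOut∘f-inj)
  where
  y≢f : ∀ i → y ≢ f i
  y≢f i y≡fi = miss (i , sym y≡fi)

  punchOut∘f-inj : Injective _≡_ _≡_ (λ i → punchOut (y≢f i))
  punchOut∘f-inj {i} {j} = f-inj ∘ punchOut-injective (y≢f i) (y≢f j)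

module _ {n : ℕ} where

  Follows : Fin n → Fin n → Set
  Follows i j = suc (toℕ i) ≡ toℕ j ⊎ (toℕ j ≡ 0 × suc (toℕ i) ≡ n)

  Follows-functional : ∀ {i j k} → Follows i j → Follows i k → j ≡ k
  Follows-functional (inj₁ i+1≡j) (inj₁ i+1≡k) = toℕ-injective (trans (sym i+1≡j) i+1≡k)
  Follows-functional {j = j} (inj₁ i+1≡j) (inj₂ (_ , i+1≡n)) =
    ⊥-elim (ℕ.<-irrefl (trans (sym i+1≡j) i+1≡n) (toℕ<n j))
  Follows-functional {k = k} (inj₂ (_ , i+1≡n)) (inj₁ i+1≡k) =
    ⊥-elim (ℕ.<-irrefl (trans (sym i+1≡k) i+1≡n) (toℕ<n k))
  Follows-functional (inj₂ (j≡0 , _)) (inj₂ (k≡0 , _)) = toℕ-injective (trans j≡0 (sym k≡0))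

  Follows-injective : ∀ {i j k} → Follows j i → Follows k i → j ≡ k
  Follows-injective (inj₁ j+1≡i) (inj₁ k+1≡i) =
    toℕ-injective (ℕ.suc-injective (trans j+1≡i (sym k+1≡i)))
  Follows-injective (inj₁ j+1≡i) (inj₂ (i≡0 , _)) = ⊥-elim (ℕ.1+n≢0 (trans j+1≡i i≡0))
  Follows-injective (inj₂ (i≡0 , _)) (inj₁ k+1≡i) = ⊥-elim (ℕ.1+n≢0 (trans k+1≡i i≡0))
  Follows-injective (inj₂ (_ , j+1≡n)) (inj₂ (_ , k+1≡n)) =
    toℕ-injective (ℕ.suc-injective (trans j+1≡n (sym k+1≡n)))

module _ {n : ℕ} (G : Graph n) where

  Edge-sym : ∀ {x y} → Edge G x y → Edge G y x
  Edge-sym {x} {y} = subst T (Graph.sym G x y)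

  Edge? : ∀ x y → Dec (Edge G x y)
  Edge? x y = T? (Graph.adj G x y)

  completeBipartite⇒noWalk₃ : IsCompleteBipartite G → ∀ {a b c d} → ¬ Edge G a b →
                              Edge G a c → Edge G c d → Edge G d b → ⊥
  completeBipartite⇒noWalk₃ (side , edge⇔) {a} {b} {c} {d} ¬ab ac cd db
    with side a Bool.≟ side b
  ... | no a≢b = ¬ab (Equivalence.from (edge⇔ a b) a≢b)
  ... | yes a≡b = Equivalence.to (edge⇔ d b) db (trans d≡a a≡b)
    where
    opposite : ∀ {x y} → Edge G x y → side x ≡ not (side y)
    opposite {x} {y} = ¬-not ∘ Equivalence.to (edge⇔ x y)

    d≡a : side d ≡ side a
    d≡a = trans (opposite (Edge-sym cd)) (sym (opposite ac))

  MaxDegree≤2 : Set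
  MaxDegree≤2 = ∀ {x y₁ y₂ y₃} → Edge G x y₁ → Edge G x y₂ → Edge G x y₃ →
                y₁ ≡ y₂ ⊎ y₁ ≡ y₃ ⊎ y₂ ≡ y₃

  CycAdj⇒Follows : ∀ {i j} → CycAdj G i j → Follows i j ⊎ Follows j i
  CycAdj⇒Follows (inj₁ i+1≡j) = inj₁ (inj₁ i+1≡j)
  CycAdj⇒Follows (inj₂ (inj₁ j+1≡i)) = inj₂ (inj₁ j+1≡i)
  CycAdj⇒Follows (inj₂ (inj₂ (inj₁ i≡0×j+1≡n))) = inj₂ (inj₂ i≡0×j+1≡n)
  CycAdj⇒Follows (inj₂ (inj₂ (inj₂ j≡0×i+1≡n))) = inj₁ (inj₂ j≡0×i+1≡n)

  CycAdj-maxDegree≤2 : ∀ {i j₁ j₂ j₃} → CycAdj G i j₁ → CycAdj G i j₂ → CycAdj G i j₃ →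
                       j₁ ≡ j₂ ⊎ j₁ ≡ j₃ ⊎ j₂ ≡ j₃
  CycAdj-maxDegree≤2 adj₁ adj₂ adj₃ =
    pigeonhole (CycAdj⇒Follows adj₁) (CycAdj⇒Follows adj₂) (CycAdj⇒Follows adj₃)
    where
    pigeonhole : ∀ {i j₁ j₂ j₃} →
                 Follows i j₁ ⊎ Follows j₁ i → Follows i j₂ ⊎ Follows j₂ i →
                 Follows i j₃ ⊎ Follows j₃ i → j₁ ≡ j₂ ⊎ j₁ ≡ j₃ ⊎ j₂ ≡ j₃
    pigeonhole (inj₁ f₁) (inj₁ f₂) _ = inj₁ (Follows-functional f₁ f₂)
    pigeonhole (inj₂ f₁) (inj₂ f₂) _ = inj₁ (Follows-injective f₁ f₂)
    pigeonhole (inj₁ f₁) (inj₂ _) (inj₁ f₃) = inj₂ (inj₁ (Follows-functional f₁ f₃))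
    pigeonhole (inj₂ f₁) (inj₁ _) (inj₂ f₃) = inj₂ (inj₁ (Follows-injective f₁ f₃))
    pigeonhole (inj₁ _) (inj₂ f₂) (inj₂ f₃) = inj₂ (inj₂ (Follows-injective f₂ f₃))
    pigeonhole (inj₂ _) (inj₁ f₂) (inj₁ f₃) = inj₂ (inj₂ (Follows-functional f₂ f₃))

  IsCycle⇒MaxDegree≤2 : IsCycle G → MaxDegree≤2
  IsCycle⇒MaxDegree≤2 (_ , f , f-inj , edge⇔) {x} {y₁} {y₂} {y₃} e₁ e₂ e₃
    with injective⇒surjective f-inj x | injective⇒surjective f-inj y₁
       | injective⇒surjective f-inj y₂ | injective⇒surjective f-inj y₃
  ... | i , refl | j₁ , refl | j₂ , refl | j₃ , refl =
    Sum.map (cong f) (Sum.map (cong f) (cong f))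
      (CycAdj-maxDegree≤2 (cycAdj e₁) (cycAdj e₂) (cycAdj e₃))
    where
    cycAdj : ∀ {j} → Edge G (f i) (f j) → CycAdj G i j
    cycAdj {j} = Equivalence.to (edge⇔ i j)

module _ {n : ℕ} {G : Graph n} where

  _∈ʷ_ : ∀ {x y} → Fin n → Walk G x y → Set
  u ∈ʷ here {x} = u ≡ x
  u ∈ʷ step {x} _ w = u ≡ x ⊎ u ∈ʷ w

  _∈ʷ?_ : ∀ {x y} u (w : Walk G x y) → Dec (u ∈ʷ w)
  u ∈ʷ? here {x} = u Fin.≟ x
  u ∈ʷ? step {x} _ w = (u Fin.≟ x) ⊎-dec (u ∈ʷ? w)

  _⊆ʷ_ : ∀ {x y x′ y′} → Walk G x y → Walk G x′ y′ → Set
  v ⊆ʷ w = ∀ {u} → u ∈ʷ v → u ∈ʷ w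

  start∈ʷ : ∀ {x y} (w : Walk G x y) → x ∈ʷ w
  start∈ʷ here = refl
  start∈ʷ (step _ _) = inj₁ refl

  _++ʷ_ : ∀ {x y z} → Walk G x y → Walk G y z → Walk G x z
  here ++ʷ w = w
  step e v ++ʷ w = step e (v ++ʷ w)

  ∈-++ʷ⁻ : ∀ {x y z u} (v : Walk G x y) {w : Walk G y z} →
           u ∈ʷ (v ++ʷ w) → u ∈ʷ v ⊎ u ∈ʷ w
  ∈-++ʷ⁻ here u∈w = inj₂ u∈w
  ∈-++ʷ⁻ (step _ v) (inj₁ u≡x) = inj₁ (inj₁ u≡x)
  ∈-++ʷ⁻ (step _ v) (inj₂ u∈v++w) = Sum.map₁ inj₂ (∈-++ʷ⁻ v u∈v++w)

  reverseʷ : ∀ {x y} → Walk G x y → Walk G y x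
  reverseʷ here = here
  reverseʷ (step e w) = reverseʷ w ++ʷ step (Edge-sym G e) here

  ∈-reverseʷ⁻ : ∀ {x y} (w : Walk G x y) → reverseʷ w ⊆ʷ w
  ∈-reverseʷ⁻ here u∈w = u∈w
  ∈-reverseʷ⁻ (step _ w) u∈rev with ∈-++ʷ⁻ (reverseʷ w) u∈rev
  ... | inj₁ u∈rev-w = inj₂ (∈-reverseʷ⁻ w u∈rev-w)
  ... | inj₂ (inj₁ refl) = inj₂ (start∈ʷ w)
  ... | inj₂ (inj₂ u≡x) = inj₁ u≡x

  IsPath : ∀ {x y} → Walk G x y → Set
  IsPath here = ⊤
  IsPath (step {x} _ w) = ¬ x ∈ʷ w × IsPath w

  dropUntil : ∀ {u y z} (p : Walk G y z) → IsPath p → u ∈ʷ p →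
              Σ (Walk G u z) λ q → IsPath q × q ⊆ʷ p
  dropUntil here _ refl = here , tt , id
  dropUntil (step e p) path (inj₁ refl) = step e p , path , id
  dropUntil (step _ p) (_ , path) (inj₂ u∈p) with dropUntil p path u∈p
  ... | q , q-path , q⊆p = q , q-path , inj₂ ∘ q⊆p

  toPath : ∀ {x y} (w : Walk G x y) → Σ (Walk G x y) λ p → IsPath p × p ⊆ʷ w
  toPath here = here , tt , id
  toPath (step {x} e w) with toPath w
  ... | p , path , p⊆w with x ∈ʷ? p
  ...   | yes x∈p = let q , q-path , q⊆p = dropUntil p path x∈p
                    in q , q-path , inj₂ ∘ p⊆w ∘ q⊆p
  ...   | no x∉p = step e p , (x∉p , path) , Sum.map₂ p⊆w

  length : ∀ {x y} → Walk G x y → ℕ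
  length here = 0
  length (step _ w) = suc (length w)

  vertex : ∀ {x y} (w : Walk G x y) → Fin (suc (length w)) → Fin n
  vertex (here {x}) _ = x
  vertex (step {x} _ w) Fin.zero = x
  vertex (step _ w) (Fin.suc i) = vertex w i

  vertex-zero : ∀ {x y} (w : Walk G x y) → vertex w Fin.zero ≡ x
  vertex-zero here = refl
  vertex-zero (step _ _) = refl

  vertex-last : ∀ {x y} (w : Walk G x y) → vertex w (fromℕ (length w)) ≡ y
  vertex-last here = refl
  vertex-last (step _ w) = vertex-last w

  vertex-edge : ∀ {x y} (w : Walk G x y) (i : Fin (length w)) →
                Edge G (vertex w (inject₁ i)) (vertex w (Fin.suc i))
  vertex-edge (step {x} e w) Fin.zero = subst (Edge G x) (sym (vertex-zero w)) e
  vertex-edge (step _ w) (Fin.suc i) = vertex-edge w i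

  vertex-∈ʷ : ∀ {x y} (w : Walk G x y) i → vertex w i ∈ʷ w
  vertex-∈ʷ here _ = refl
  vertex-∈ʷ (step _ _) Fin.zero = inj₁ refl
  vertex-∈ʷ (step _ w) (Fin.suc i) = inj₂ (vertex-∈ʷ w i)

  vertex-≢ : ∀ {x y u} (w : Walk G x y) → ¬ u ∈ʷ w → ∀ i → vertex w i ≢ u
  vertex-≢ w u∉w i refl = u∉w (vertex-∈ʷ w i)

  vertex-injective : ∀ {x y} (p : Walk G x y) → IsPath p → Injective _≡_ _≡_ (vertex p)
  vertex-injective here _ {Fin.zero} {Fin.zero} _ = refl
  vertex-injective (step _ _) _ {Fin.zero} {Fin.zero} _ = refl
  vertex-injective (step _ p) (x∉p , _) {Fin.zero} {Fin.suc j} = ⊥-elim ∘ vertex-≢ p x∉p j ∘ sym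
  vertex-injective (step _ p) (x∉p , _) {Fin.suc i} {Fin.zero} = ⊥-elim ∘ vertex-≢ p x∉p i
  vertex-injective (step _ p) (_ , path) {Fin.suc i} {Fin.suc j} =
    cong Fin.suc ∘ vertex-injective p path

  closePath : ∀ {a c d} → Edge G c a → Edge G d c → (p : Walk G a d) → IsPath p →
              a ≢ d → ¬ c ∈ʷ p → HasCycle G
  closePath _ _ here _ a≢a _ = ⊥-elim (a≢a refl)
  closePath {c = c} ca dc p@(step _ p′) path _ c∉p =
    length p′ , cycle , cycle-injective , cycle-edge , cycle-closed
    where
    cycle : Fin (suc (suc (length p))) → Fin n
    cycle Fin.zero = c
    cycle (Fin.suc i) = vertex p i

    cycle-injective : Injective _≡_ _≡_ cycle
    cycle-injective {Fin.zero} {Fin.zero} _ = refl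
    cycle-injective {Fin.zero} {Fin.suc j} = ⊥-elim ∘ vertex-≢ p c∉p j ∘ sym
    cycle-injective {Fin.suc i} {Fin.zero} = ⊥-elim ∘ vertex-≢ p c∉p i
    cycle-injective {Fin.suc i} {Fin.suc j} = cong Fin.suc ∘ vertex-injective p path

    cycle-edge : ∀ (i : Fin (suc (length p))) → Edge G (cycle (inject₁ i)) (cycle (Fin.suc i))
    cycle-edge Fin.zero = ca
    cycle-edge (Fin.suc i) = vertex-edge p i

    cycle-closed : Edge G (cycle (fromℕ (suc (length p)))) (cycle Fin.zero)
    cycle-closed = subst (λ u → Edge G u c) (sym (vertex-last p)) dc

  forest⇒commonNeighbour-unique : IsForest G → ∀ {a c d} → Edge G a c → Edge G d c →
                                  (w : Walk G a d) → ¬ c ∈ʷ w → a ≡ d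
  forest⇒commonNeighbour-unique forest {a} {c} {d} ac dc w c∉w with a Fin.≟ d
  ... | yes a≡d = a≡d
  ... | no a≢d =
    let p , path , p⊆w = toPath w
    in ⊥-elim (forest (closePath (Edge-sym G ac) dc p path a≢d (c∉w ∘ p⊆w)))

module BFS {n : ℕ} (G : Graph n) (σ : Ordering n) (connected : Connected G) (bfs : IsBFS G σ) where
  open Ordering σ

  _≺_ : Fin n → Fin n → Set
  x ≺ y = x <[ σ ] y

  _≼_ : Fin n → Fin n → Set
  x ≼ y = pos x Fin.≤ pos y

  ≺-irrefl : ∀ {x} → ¬ x ≺ x
  ≺-irrefl = <-irrefl refl

  ≺⇒≢ : ∀ {x y} → x ≺ y → x ≢ y
  ≺⇒≢ x≺y refl = ≺-irrefl x≺y

  ≺-wellFounded : WellFounded _≺_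
  ≺-wellFounded = On.wellFounded pos <-wellFounded

  -- Follow the walk to its first step from a vertex before v to one not before v.
  earlierNeighbour : ∀ {x v} → Walk G x v → x ≺ v → ∃ λ u → u ≺ v × Edge G u v
  earlierNeighbour here x≺x = ⊥-elim (≺-irrefl x≺x)
  earlierNeighbour {x} {v} (step {y = y} xy w) x≺v with <-cmp (pos y) (pos v)
  ... | tri< y≺v _ _ = earlierNeighbour w y≺v
  ... | tri≈ _ y≡v _ = x , x≺v , subst (Edge G x) (pos-inj y≡v) xy
  ... | tri> _ _ v≺y with Edge? G x v
  ...   | yes xv = x , x≺v , xv
  ...   | no ¬xv = let d , d≺x , dv = bfs x v y x≺v v≺y xy ¬xv
                   in d , <-trans d≺x x≺v , dv

  First : Fin n → Set
  First r = ∀ x → ¬ x ≺ r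

  First-unique : ∀ {r r′} → First r → First r′ → r ≡ r′
  First-unique {r} {r′} r-first r′-first with <-cmp (pos r) (pos r′)
  ... | tri< r≺r′ _ _ = ⊥-elim (r′-first r r≺r′)
  ... | tri≈ _ r≡r′ _ = pos-inj r≡r′
  ... | tri> _ _ r′≺r = ⊥-elim (r-first r′ r′≺r)

  descendToFirst : ∀ v → Acc _≺_ v →
                   ∃ λ r → First r × Σ (Walk G v r) λ w → ∀ {u} → u ∈ʷ w → u ≼ v
  descendToFirst v (acc earlier) with any? (λ x → pos x Fin.<? pos v)
  ... | no nothing-before = v , (λ x x≺v → nothing-before (x , x≺v)) , here , λ { refl → ≤-refl }
  ... | yes (x , x≺v) with earlierNeighbour (connected x v) x≺v
  ...   | u , u≺v , uv with descendToFirst u (earlier u≺v)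
  ...     | r , r-first , w , w≼u =
    r , r-first , step (Edge-sym G uv) w ,
    λ { (inj₁ refl) → ≤-refl ; (inj₂ u′∈w) → ≤-trans (w≼u u′∈w) (ℕ.<⇒≤ u≺v) }

  forest⇒earlierNeighbour-unique : IsForest G → ∀ {a c d} → a ≺ c → d ≺ c →
                                   Edge G a c → Edge G d c → a ≡ d
  forest⇒earlierNeighbour-unique forest {a} {c} {d} a≺c d≺c ac dc
    with descendToFirst a (≺-wellFounded a) | descendToFirst d (≺-wellFounded d)
  ... | r , r-first , wa , wa≼a | r′ , r′-first , wd , wd≼d with First-unique r-first r′-first
  ... | refl = forest⇒commonNeighbour-unique forest ac dc (wa ++ʷ reverseʷ wd) c∉
    where
    c∉ : ¬ c ∈ʷ (wa ++ʷ reverseʷ wd)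
    c∉ c∈ with ∈-++ʷ⁻ wa c∈
    ... | inj₁ c∈wa = ≺-irrefl (ℕ.≤-<-trans (wa≼a c∈wa) a≺c)
    ... | inj₂ c∈wd = ≺-irrefl (ℕ.≤-<-trans (wd≼d (∈-reverseʷ⁻ wd c∈wd)) d≺c)

  First-adjacent : ∀ {a c d} → First d → d ≺ a → a ≺ c → Edge G d c → Edge G d a
  First-adjacent {a} {c} {d} d-first d≺a a≺c dc with Edge? G d a
  ... | yes da = da
  ... | no ¬da = let e , e≺d , _ = bfs d a c d≺a a≺c dc ¬da in ⊥-elim (d-first e e≺d)

  maxDegree≤2⇒¬gapBeforeLaterNeighbours : MaxDegree≤2 G → ∀ {a b c d} →
                                          d ≺ a → a ≺ b → b ≺ c → Edge G d b → Edge G d c → ⊥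
  maxDegree≤2⇒¬gapBeforeLaterNeighbours maxDegree {a} {b} {c} {d} d≺a a≺b b≺c db dc =
    noThreeNeighbours a≺b b≺c (First-adjacent d-first d≺a (<-trans a≺b b≺c) dc) db dc
    where
    noThreeNeighbours : ∀ {x y₁ y₂ y₃} → y₁ ≺ y₂ → y₂ ≺ y₃ →
                        Edge G x y₁ → Edge G x y₂ → Edge G x y₃ → ⊥
    noThreeNeighbours y₁≺y₂ y₂≺y₃ e₁ e₂ e₃ with maxDegree e₁ e₂ e₃
    ... | inj₁ refl = ≺-irrefl y₁≺y₂
    ... | inj₂ (inj₁ refl) = ≺-irrefl (<-trans y₁≺y₂ y₂≺y₃)
    ... | inj₂ (inj₂ refl) = ≺-irrefl y₂≺y₃

    d-first : First d
    d-first x x≺d =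
      let e , e≺d , ed = earlierNeighbour (connected x d) x≺d
      in noThreeNeighbours (<-trans e≺d (<-trans d≺a a≺b)) b≺c (Edge-sym G ed) db dc

lemma4 : ∀ (n : ℕ) (G : Graph n) → Connected G →
    (IsCycle G ⊎ IsForest G ⊎ IsComplete G ⊎ IsCompleteBipartite G) →
    ∀ (σ : Ordering n) → IsBFS G σ → IsLexBFS G σ
lemma4 n G connected class σ bfs a b c a≺b b≺c ac ¬ab with bfs a b c a≺b b≺c ac ¬ab
... | d , d≺a , db with Edge? G d c
... | no ¬dc = d , d≺a , db , ¬dc
... | yes dc = ⊥-elim (excluded class)
  where
  open BFS G σ connected bfs

  excluded : IsCycle G ⊎ IsForest G ⊎ IsComplete G ⊎ IsCompleteBipartite G → ⊥
  excluded (inj₁ cycle) =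
    maxDegree≤2⇒¬gapBeforeLaterNeighbours (IsCycle⇒MaxDegree≤2 G cycle) d≺a a≺b b≺c db dc
  excluded (inj₂ (inj₁ forest)) =
    ≺⇒≢ d≺a (sym (forest⇒earlierNeighbour-unique forest a≺c (<-trans d≺a a≺c) ac dc))
    where
    a≺c : a ≺ c
    a≺c = <-trans a≺b b≺c
  excluded (inj₂ (inj₂ (inj₁ complete))) = ¬ab (complete a b (≺⇒≢ a≺b))
  excluded (inj₂ (inj₂ (inj₂ bipartite))) =
    completeBipartite⇒noWalk₃ G bipartite ¬ab ac (Edge-sym G dc) db
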